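{- Let $n\in\mathbb{N}$ and $(a_1,\ldots,a_n)\in\mathcal{A}_n$ such that $a_i>a_{i+1}+1$ for some $1\le i\le n-1$. Define $(a'_1,\ldots,a'_n)$ by $a'_k=a_k$ for $k\ne i,i+1$, $a'_i=a_i-1$ and $a'_{i+1}=a_{i+1}+1$. Then $(a'_1,\ldots,a'_n)\in\mathcal{A}_n$ and $c_{(a'_1,\ldots,a'_n)}\ge c_{(a_1,\ldots,a_n)}$.
   Context: For $n\in\mathbb{N}$ and indeterminates $x_1,\ldots,x_n$, let $p_n=x_1(x_1+x_2)\cdots(x_1+x_2+\cdots+x_n)$. Let $\mathbb{N}_0=\mathbb{N}\cup\{0\}$ and $\mathcal{A}_n=\{(a_1,\ldots,a_n)\in\mathbb{N}_0^n : \sum_{i=k+1}^n a_i\le n-k \text{ for all } 1\le k\le n-1,\ \sum_{i=1}^n a_i=n\}$. For $a\in\mathcal{A}_n$, $c_a$ denotes the coefficient of $x_1^{a_1}\cdots x_n^{a_n}$ in the expansion of $p_n$. -}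

module Defs where

open import Data.Nat using (ℕ; zero; suc; _+_; _*_; _∸_; _≤_; _<_; _<?_)
open import Data.Nat.Properties using (_≟_)
open import Data.Fin using (Fin; toℕ)
open import Data.Vec using (Vec; replicate; zipWith; toList; _[_]≔_)
open import Data.Vec.Properties using (≡-dec)
open import Data.List using (List; []; _∷_; _++_; map; concatMap; foldr; filter; drop; upTo)
open import Data.Nat.ListAction using (sum)
open import Data.List.Base using (allFin)
open import Data.Product using (_×_; _,_)
open import Relation.Nullary using (yes; no)
open import Relation.Binary.PropositionalEquality using (_≡_)

-- A polynomial in x_1..x_n with ℕ coefficients, as a formal (unsimplified)
-- sum of terms  c · x^e  (coefficient c, exponent vector e).
Poly : ℕ → Set
Poly n = List (ℕ × Vec ℕ n)

_⊕_ : ∀ {n} → Poly n → Poly n → Poly n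
p ⊕ q = p ++ q

_⊗_ : ∀ {n} → Poly n → Poly n → Poly n
p ⊗ q = concatMap (λ { (c , e) → map (λ { (d , f) → (c * d , zipWith _+_ e f) }) q }) p

one : ∀ {n} → Poly n
one {n} = (1 , replicate n 0) ∷ []

-- the variable x_{i+1} (0-based index i)
var : ∀ {n} → Fin n → Poly n
var {n} i = (1 , (replicate n 0 [ i ]≔ 1)) ∷ []

coeff : ∀ {n} → Vec ℕ n → Poly n → ℕ
coeff a [] = 0
coeff a ((c , e) ∷ p) with ≡-dec _≟_ e a
... | yes _ = c + coeff a p
... | no  _ = coeff a p

linForm : (n k : ℕ) → Poly n
linForm n k = foldr _⊕_ [] (map var (filter (λ i → toℕ i <? k) (allFin n)))

pPoly : (n : ℕ) → Poly n
pPoly n = foldr _⊗_ one (map (λ k → linForm n (suc k)) (upTo n))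

c : ∀ {n} → Vec ℕ n → ℕ
c {n} a = coeff a (pPoly n)

-- sum_{i=k+1}^n a_i  (1-based), i.e. the sum of the entries after the first k
tailSum : ∀ {n} → ℕ → Vec ℕ n → ℕ
tailSum k a = sum (drop k (toList a))

InA : (n : ℕ) → Vec ℕ n → Set
InA n a = ((k : ℕ) → 1 ≤ k → k ≤ n ∸ 1 → tailSum k a ≤ n ∸ k)
        × sum (toList a) ≡ n

-- Expanding a product of the forms x_0 + … + x_k along its first factor gives a recursion for the
-- coefficients. Every factor containing both x_p and x_{p+1} depends on them only through their sum, so
-- ∂/∂x_p and ∂/∂x_{p+1} agree on a product of such factors; on coefficients this reads
-- (b_{p+1} + 1) c(b − e_p + e_{p+1}) = b_p c(b). In p_n exactly one factor, x_0 + … + x_p, contains x_p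
-- but not x_{p+1}; passing through it refines the relation to (β + 1)(U + 1) c(b′) = α U c(b), where
-- α = b_p, β = b_{p+1}, b′ = b − e_p + e_{p+1} and U = (n − p − 1) − (b_{p+1} + … + b_{n−1}); it closes up
-- because U = b_0 + … + b_{p−1} + α − 1 whenever b has degree n. Membership in 𝒜_n gives U ≥ β + 1, and
-- together with α ≥ β + 2 this makes α U ≥ (β + 1)(U + 1), whence c(b′) ≥ c(b).
module Submission where

open import Defs
open import Data.Nat using (ℕ; zero; suc; _+_; _*_; _∸_; _≤_; _<_; _>_; pred; z≤n; s≤s; _<?_; >-nonZero)
open import Data.Nat.Properties
open import Data.Nat.ListAction using (sum)
open import Data.Fin using (Fin; toℕ; fromℕ<) renaming (zero to fzero; suc to fsuc)
open import Data.Fin.Properties using (toℕ<n)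
open import Data.Vec using (Vec; []; _∷_; lookup; _[_]%=_; replicate; zipWith; toList; _[_]≔_)
open import Data.Vec.Properties using (≡-dec)
open import Data.List using (List; []; _∷_; _++_; map; foldr; filter; applyUpTo; upTo; tabulate; allFin; length)
open import Data.List.Properties using (map-cong; map-tabulate; ++-assoc; length-applyUpTo)
open import Data.List.Relation.Unary.All as All using (All; []; _∷_)
open import Data.List.Relation.Unary.All.Properties using (applyUpTo⁺₁)
open import Data.Bool using (true; false; if_then_else_)
open import Relation.Unary using (Decidable)
open import Data.Product using (_×_; _,_; proj₂)
open import Relation.Nullary using (yes; no; does; contradiction)
open import Relation.Binary.PropositionalEquality
open import Relation.Binary.Definitions using (tri<; tri≈; tri>)
open import Data.Empty using (⊥-elim)
open import Function using (_∘_; id)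
open import Data.Nat.Tactic.RingSolver using (solve-∀)

private variable
  n : ℕ

-- Entries of a vector indexed by ℕ: reading out of range gives 0, updating out of range does nothing.
_!_ : Vec ℕ n → ℕ → ℕ
[] ! j = 0
(x ∷ v) ! zero = x
(x ∷ v) ! suc j = v ! j

adjust : ℕ → (ℕ → ℕ) → Vec ℕ n → Vec ℕ n
adjust j f [] = []
adjust zero f (x ∷ v) = f x ∷ v
adjust (suc j) f (x ∷ v) = x ∷ adjust j f v

lower raise : ℕ → Vec ℕ n → Vec ℕ n
lower j = adjust j pred
raise j = adjust j suc

move : ℕ → ℕ → Vec ℕ n → Vec ℕ n
move x y v = raise y (lower x v)

!-adjust-≡ : ∀ j f (v : Vec ℕ n) → j < n → adjust j f v ! j ≡ f (v ! j)
!-adjust-≡ zero f (x ∷ v) _ = refl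
!-adjust-≡ (suc j) f (x ∷ v) (s≤s j<n) = !-adjust-≡ j f v j<n

!-adjust-≢ : ∀ j k f (v : Vec ℕ n) → j ≢ k → adjust j f v ! k ≡ v ! k
!-adjust-≢ j k f [] _ = refl
!-adjust-≢ zero zero f (x ∷ v) j≢k = ⊥-elim (j≢k refl)
!-adjust-≢ zero (suc k) f (x ∷ v) _ = refl
!-adjust-≢ (suc j) zero f (x ∷ v) _ = refl
!-adjust-≢ (suc j) (suc k) f (x ∷ v) j≢k = !-adjust-≢ j k f v (j≢k ∘ cong suc)

adjust-comm : ∀ j k f g (v : Vec ℕ n) → j ≢ k → adjust j f (adjust k g v) ≡ adjust k g (adjust j f v)
adjust-comm j k f g [] _ = refl
adjust-comm zero zero f g (x ∷ v) j≢k = ⊥-elim (j≢k refl)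
adjust-comm zero (suc k) f g (x ∷ v) _ = refl
adjust-comm (suc j) zero f g (x ∷ v) _ = refl
adjust-comm (suc j) (suc k) f g (x ∷ v) j≢k = cong (x ∷_) (adjust-comm j k f g v (j≢k ∘ cong suc))

!-pos⇒< : ∀ (v : Vec ℕ n) j → 1 ≤ v ! j → j < n
!-pos⇒< (x ∷ v) zero _ = s≤s z≤n
!-pos⇒< (x ∷ v) (suc j) p = s≤s (!-pos⇒< v j p)

!-replicate : ∀ n j → replicate n 0 ! j ≡ 0
!-replicate zero j = refl
!-replicate (suc n) zero = refl
!-replicate (suc n) (suc j) = !-replicate n j

raise-lower : ∀ j (v : Vec ℕ n) → 1 ≤ v ! j → raise j (lower j v) ≡ v
raise-lower zero (suc x ∷ v) _ = refl
raise-lower (suc j) (x ∷ v) p = cong (x ∷_) (raise-lower j v p)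

lower-raise : ∀ j (v : Vec ℕ n) → lower j (raise j v) ≡ v
lower-raise j [] = refl
lower-raise zero (x ∷ v) = refl
lower-raise (suc j) (x ∷ v) = cong (x ∷_) (lower-raise j v)

adjust-fromℕ< : ∀ j (j<n : j < n) f (v : Vec ℕ n) → v [ fromℕ< j<n ]%= f ≡ adjust j f v
adjust-fromℕ< zero (s≤s _) f (x ∷ v) = refl
adjust-fromℕ< (suc j) (s≤s j<n) f (x ∷ v) = cong (x ∷_) (adjust-fromℕ< j j<n f v)

lookup-fromℕ< : ∀ j (j<n : j < n) (v : Vec ℕ n) → lookup v (fromℕ< j<n) ≡ v ! j
lookup-fromℕ< zero (s≤s _) (x ∷ v) = refl
lookup-fromℕ< (suc j) (s≤s j<n) (x ∷ v) = lookup-fromℕ< j j<n v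

module _ {x y : ℕ} (b : Vec ℕ n) where

  !-move-≢ : ∀ {j} → j ≢ x → j ≢ y → move x y b ! j ≡ b ! j
  !-move-≢ j≢x j≢y = trans (!-adjust-≢ y _ suc (lower x b) (j≢y ∘ sym)) (!-adjust-≢ x _ pred b (j≢x ∘ sym))

  lower-move : ∀ {j} → j ≢ x → j ≢ y → lower j (move x y b) ≡ move x y (lower j b)
  lower-move {j} j≢x j≢y = trans (adjust-comm j y pred suc (lower x b) j≢y) (cong (raise y) (adjust-comm j x pred pred b j≢x))

  !-move-source : x ≢ y → x < n → move x y b ! x ≡ pred (b ! x)
  !-move-source x≢y x<n = trans (!-adjust-≢ y x suc (lower x b) (x≢y ∘ sym)) (!-adjust-≡ x pred b x<n)

  !-move-target : x ≢ y → y < n → move x y b ! y ≡ suc (b ! y)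
  !-move-target x≢y y<n = trans (!-adjust-≡ y suc (lower x b) y<n) (cong suc (!-adjust-≢ x y pred b x≢y))

  lower-move-target : lower y (move x y b) ≡ lower x b
  lower-move-target = lower-raise y (lower x b)

  lower-move-source : x ≢ y → lower x (move x y b) ≡ move x y (lower x b)
  lower-move-source x≢y = adjust-comm x y pred suc (lower x b) x≢y

  move-lower-target : x ≢ y → 1 ≤ b ! y → move x y (lower y b) ≡ lower x b
  move-lower-target x≢y py =
    trans (cong (raise y) (adjust-comm x y pred pred b x≢y))
          (raise-lower y (lower x b) (subst (1 ≤_) (sym (!-adjust-≢ x y pred b x≢y)) py))

∑< : ℕ → (ℕ → ℕ) → ℕ
∑< K f = sum (applyUpTo f K)

∑<-cong : ∀ K {f g : ℕ → ℕ} → (∀ j → j < K → f j ≡ g j) → ∑< K f ≡ ∑< K g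
∑<-cong zero _ = refl
∑<-cong (suc K) f≗g = cong₂ _+_ (f≗g 0 (s≤s z≤n)) (∑<-cong K (λ j j<K → f≗g (suc j) (s≤s j<K)))

∑<-*ˡ : ∀ K c (f : ℕ → ℕ) → ∑< K (λ j → c * f j) ≡ c * ∑< K f
∑<-*ˡ zero c f = sym (*-zeroʳ c)
∑<-*ˡ (suc K) c f = trans (cong (c * f 0 +_) (∑<-*ˡ K c (f ∘ suc))) (sym (*-distribˡ-+ c (f 0) _))

∑<-*ʳ : ∀ K (f : ℕ → ℕ) c → ∑< K (λ j → f j * c) ≡ ∑< K f * c
∑<-*ʳ K f c = trans (∑<-cong K (λ j _ → *-comm (f j) c)) (trans (∑<-*ˡ K c f) (*-comm c _))

∑<-zero : ∀ K → ∑< K (λ _ → 0) ≡ 0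
∑<-zero zero = refl
∑<-zero (suc K) = ∑<-zero K

∑<-suc : ∀ K f → ∑< (suc K) f ≡ ∑< K f + f K
∑<-suc zero f = +-comm (f 0) 0
∑<-suc (suc K) f = trans (cong (f 0 +_) (∑<-suc K (f ∘ suc))) (sym (+-assoc (f 0) _ _))

∑<-truncate : ∀ m K (f : ℕ → ℕ) → K ≤ m → ∑< m (λ j → if does (j <? K) then f j else 0) ≡ ∑< K f
∑<-truncate m zero f _ = ∑<-zero m
∑<-truncate (suc m) (suc K) f (s≤s K≤m) = cong (f 0 +_) (∑<-truncate m K (f ∘ suc) K≤m)

∑<-exchange : ∀ K x {f g : ℕ → ℕ} → x < K → (∀ j → j < K → j ≢ x → f j ≡ g j) →
              ∑< K f + g x ≡ ∑< K g + f x
∑<-exchange (suc K) zero {f} {g} _ f≗g = begin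
    f 0 + ∑< K (f ∘ suc) + g 0  ≡⟨ cong (λ s → f 0 + s + g 0) (∑<-cong K (λ j j<K → f≗g (suc j) (s≤s j<K) λ ())) ⟩
    f 0 + ∑< K (g ∘ suc) + g 0  ≡⟨ swap (f 0) _ (g 0) ⟩
    g 0 + ∑< K (g ∘ suc) + f 0  ∎
  where
  open ≡-Reasoning
  swap : ∀ a s c → a + s + c ≡ c + s + a
  swap = solve-∀
∑<-exchange (suc K) (suc x) {f} {g} (s≤s x<K) f≗g =
  trans (+-assoc (f 0) _ _)
        (trans (cong₂ _+_ (f≗g 0 (s≤s z≤n) λ ())
                          (∑<-exchange K x x<K (λ j j<K j≢x → f≗g (suc j) (s≤s j<K) (j≢x ∘ suc-injective))))
               (sym (+-assoc (g 0) _ _)))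

private
  ∑<-exchange₂-zero : ∀ K y {f g : ℕ → ℕ} → y < K →
                      (∀ j → j < suc K → j ≢ 0 → j ≢ suc y → f j ≡ g j) →
                      f 0 + f (suc y) ≡ g 0 + g (suc y) → ∑< (suc K) f ≡ ∑< (suc K) g
  ∑<-exchange₂-zero K y {f} {g} y<K f≗g pair = +-cancelʳ-≡ (g (suc y)) _ _ (begin
      f 0 + Sf + g (suc y)    ≡⟨ +-assoc (f 0) Sf _ ⟩
      f 0 + (Sf + g (suc y))  ≡⟨ cong (f 0 +_) exchanged ⟩
      f 0 + (Sg + f (suc y))  ≡⟨ regroup (f 0) Sg _ ⟩
      Sg + (f 0 + f (suc y))  ≡⟨ cong (Sg +_) pair ⟩
      Sg + (g 0 + g (suc y))  ≡⟨ regroup′ Sg (g 0) _ ⟩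
      g 0 + Sg + g (suc y)    ∎)
    where
    open ≡-Reasoning
    Sf = ∑< K (f ∘ suc)
    Sg = ∑< K (g ∘ suc)
    exchanged : Sf + g (suc y) ≡ Sg + f (suc y)
    exchanged = ∑<-exchange K y y<K (λ j j<K j≢y → f≗g (suc j) (s≤s j<K) (λ ()) (j≢y ∘ suc-injective))
    regroup : ∀ a s b → a + (s + b) ≡ s + (a + b)
    regroup = solve-∀
    regroup′ : ∀ s a b → s + (a + b) ≡ a + s + b
    regroup′ = solve-∀

∑<-exchange₂ : ∀ K x y {f g : ℕ → ℕ} → x < K → y < K → x ≢ y →
               (∀ j → j < K → j ≢ x → j ≢ y → f j ≡ g j) →
               f x + f y ≡ g x + g y → ∑< K f ≡ ∑< K g
∑<-exchange₂ (suc K) zero zero _ _ x≢y _ _ = ⊥-elim (x≢y refl)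
∑<-exchange₂ (suc K) zero (suc y) _ (s≤s y<K) _ f≗g pair = ∑<-exchange₂-zero K y y<K f≗g pair
∑<-exchange₂ (suc K) (suc x) zero {f} {g} (s≤s x<K) _ _ f≗g pair =
  ∑<-exchange₂-zero K x x<K (λ j j<K j≢0 j≢x → f≗g j j<K j≢x j≢0) (trans (+-comm (f 0) _) (trans pair (+-comm _ (g 0))))
∑<-exchange₂ (suc K) (suc x) (suc y) {f} {g} (s≤s x<K) (s≤s y<K) x≢y f≗g pair =
  cong₂ _+_ (f≗g 0 (s≤s z≤n) (λ ()) (λ ()))
            (∑<-exchange₂ K x y x<K y<K (x≢y ∘ cong suc)
              (λ j j<K j≢x j≢y → f≗g (suc j) (s≤s j<K) (j≢x ∘ suc-injective) (j≢y ∘ suc-injective)) pair)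

tailSum-[] : ∀ k → tailSum k [] ≡ 0
tailSum-[] zero = refl
tailSum-[] (suc k) = refl

tailSum-split : ∀ k (v : Vec ℕ n) → tailSum k v ≡ v ! k + tailSum (suc k) v
tailSum-split k [] = trans (tailSum-[] k) (sym (tailSum-[] (suc k)))
tailSum-split zero (x ∷ v) = refl
tailSum-split (suc k) (x ∷ v) = tailSum-split k v

sum≡∑<+tailSum : ∀ k (v : Vec ℕ n) → sum (toList v) ≡ ∑< k (v !_) + tailSum k v
sum≡∑<+tailSum zero v = refl
sum≡∑<+tailSum (suc k) [] = sym (trans (cong (_+ tailSum (suc k) []) (∑<-zero k)) (tailSum-[] (suc k)))
sum≡∑<+tailSum (suc k) (x ∷ v) = trans (cong (x +_) (sum≡∑<+tailSum k v)) (sym (+-assoc x _ _))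

tailSum-adjust-< : ∀ j k f (v : Vec ℕ n) → j < k → tailSum k (adjust j f v) ≡ tailSum k v
tailSum-adjust-< j k f [] _ = refl
tailSum-adjust-< zero (suc k) f (x ∷ v) _ = refl
tailSum-adjust-< (suc j) (suc k) f (x ∷ v) (s≤s j<k) = tailSum-adjust-< j k f v j<k

tailSum-raise : ∀ j k (v : Vec ℕ n) → k ≤ j → j < n → tailSum k (raise j v) ≡ suc (tailSum k v)
tailSum-raise zero zero (x ∷ v) _ _ = refl
tailSum-raise (suc j) zero (x ∷ v) _ (s≤s j<n) = trans (cong (x +_) (tailSum-raise j zero v z≤n j<n)) (+-suc x _)
tailSum-raise (suc j) (suc k) (x ∷ v) (s≤s k≤j) (s≤s j<n) = tailSum-raise j k v k≤j j<n

tailSum-lower : ∀ j k (v : Vec ℕ n) → k ≤ j → 1 ≤ v ! j → suc (tailSum k (lower j v)) ≡ tailSum k v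
tailSum-lower zero zero (suc x ∷ v) _ _ = refl
tailSum-lower (suc j) zero (x ∷ v) _ p = trans (sym (+-suc x _)) (cong (x +_) (tailSum-lower j zero v z≤n p))
tailSum-lower (suc j) (suc k) (x ∷ v) (s≤s k≤j) p = tailSum-lower j k v k≤j p

module _ {x y : ℕ} (b : Vec ℕ n) where

  tailSum-move-≤ : ∀ k → k ≤ x → k ≤ y → y < n → 1 ≤ b ! x → tailSum k (move x y b) ≡ tailSum k b
  tailSum-move-≤ k k≤x k≤y y<n px = trans (tailSum-raise y k (lower x b) k≤y y<n) (tailSum-lower x k b k≤x px)

  tailSum-move-> : ∀ k → x < k → y < k → tailSum k (move x y b) ≡ tailSum k b
  tailSum-move-> k x<k y<k = trans (tailSum-adjust-< y k suc (lower x b) y<k) (tailSum-adjust-< x k pred b x<k)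

  tailSum-move-between : ∀ k → x < k → k ≤ y → y < n → tailSum k (move x y b) ≡ suc (tailSum k b)
  tailSum-move-between k x<k k≤y y<n =
    trans (tailSum-raise y k (lower x b) k≤y y<n) (cong suc (tailSum-adjust-< x k pred b x<k))

  sum-move : y < n → 1 ≤ b ! x → sum (toList (move x y b)) ≡ sum (toList b)
  sum-move = tailSum-move-≤ 0 z≤n z≤n

ifPos : ℕ → ℕ → ℕ
ifPos zero _ = 0
ifPos (suc _) u = u

ifPos-pos : ∀ a u → 1 ≤ a → ifPos a u ≡ u
ifPos-pos (suc a) u _ = refl

ifPos-zero : ∀ a → ifPos a 0 ≡ 0
ifPos-zero zero = refl
ifPos-zero (suc a) = refl

ifPos-+ : ∀ a u v → ifPos a (u + v) ≡ ifPos a u + ifPos a v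
ifPos-+ zero u v = refl
ifPos-+ (suc a) u v = refl

*-ifPos : ∀ a {u v} c d → (1 ≤ a → c * u ≡ d * v) → c * ifPos a u ≡ d * ifPos a v
*-ifPos zero c d _ = trans (*-zeroʳ c) (sym (*-zeroʳ d))
*-ifPos (suc a) c d h = h (s≤s z≤n)

*-ifPos-self : ∀ a u → a * ifPos a u ≡ a * u
*-ifPos-self zero u = refl
*-ifPos-self (suc a) u = refl

coeffOf : Vec ℕ n → ℕ × Vec ℕ n → ℕ
coeffOf a (c , e) = if does (≡-dec _≟_ e a) then c else 0

coeff-∷ : ∀ (a : Vec ℕ n) t p → coeff a (t ∷ p) ≡ coeffOf a t + coeff a p
coeff-∷ a (c , e) p with ≡-dec _≟_ e a
... | yes _ = refl
... | no _ = refl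

coeff-++ : ∀ (a : Vec ℕ n) p q → coeff a (p ++ q) ≡ coeff a p + coeff a q
coeff-++ a [] q = refl
coeff-++ a (t ∷ p) q = begin
  coeff a (t ∷ p ++ q)               ≡⟨ coeff-∷ a t (p ++ q) ⟩
  coeffOf a t + coeff a (p ++ q)     ≡⟨ cong (coeffOf a t +_) (coeff-++ a p q) ⟩
  coeffOf a t + (coeff a p + coeff a q) ≡⟨ sym (+-assoc (coeffOf a t) _ _) ⟩
  coeffOf a t + coeff a p + coeff a q ≡⟨ cong (_+ coeff a q) (sym (coeff-∷ a t p)) ⟩
  coeff a (t ∷ p) + coeff a q        ∎
  where open ≡-Reasoning

coeffOf-raise : ∀ j c (f a : Vec ℕ n) → j < n → coeffOf a (c , raise j f) ≡ ifPos (a ! j) (coeffOf (lower j a) (c , f))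
coeffOf-raise j c f a j<n with a ! j in a!j
... | zero with ≡-dec _≟_ (raise j f) a
...   | yes refl = contradiction (trans (sym (!-adjust-≡ j suc f j<n)) a!j) λ ()
...   | no _ = refl
coeffOf-raise j c f a j<n | suc _ with ≡-dec _≟_ (raise j f) a | ≡-dec _≟_ f (lower j a)
... | yes _ | yes _ = refl
... | no _ | no _ = refl
... | yes refl | no f≢ = contradiction (sym (lower-raise j f)) f≢
... | no raised≢ | yes refl = contradiction (raise-lower j a (subst (1 ≤_) (sym a!j) (s≤s z≤n))) raised≢

zipWith-unit : ∀ (i : Fin n) f → zipWith _+_ (replicate n 0 [ i ]≔ 1) f ≡ raise (toℕ i) f
zipWith-unit fzero (x ∷ f) = cong (suc x ∷_) (zipWith-identity f)
  where
  zipWith-identity : ∀ {m} (f : Vec ℕ m) → zipWith _+_ (replicate m 0) f ≡ f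
  zipWith-identity [] = refl
  zipWith-identity (x ∷ f) = cong (x ∷_) (zipWith-identity f)
zipWith-unit (fsuc i) (x ∷ f) = cong (x ∷_) (zipWith-unit i f)

coeff-var-⊗ : ∀ (a : Vec ℕ n) i q → coeff a (var i ⊗ q) ≡ ifPos (a ! toℕ i) (coeff (lower (toℕ i) a) q)
coeff-var-⊗ a i [] = sym (ifPos-zero (a ! toℕ i))
coeff-var-⊗ {n} a i ((d , f) ∷ q) = begin
  coeff a (var i ⊗ ((d , f) ∷ q))
    ≡⟨ coeff-∷ a (1 * d , zipWith _+_ (replicate n 0 [ i ]≔ 1) f) (var i ⊗ q) ⟩
  coeffOf a (1 * d , zipWith _+_ (replicate n 0 [ i ]≔ 1) f) + coeff a (var i ⊗ q)
    ≡⟨ cong₂ (λ c e → coeffOf a (c , e) + coeff a (var i ⊗ q)) (*-identityˡ d) (zipWith-unit i f) ⟩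
  coeffOf a (d , raise j f) + coeff a (var i ⊗ q)
    ≡⟨ cong₂ _+_ (coeffOf-raise j d f a (toℕ<n i)) (coeff-var-⊗ a i q) ⟩
  ifPos (a ! j) (coeffOf (lower j a) (d , f)) + ifPos (a ! j) (coeff (lower j a) q)
    ≡⟨ sym (ifPos-+ (a ! j) _ _) ⟩
  ifPos (a ! j) (coeffOf (lower j a) (d , f) + coeff (lower j a) q)
    ≡⟨ cong (ifPos (a ! j)) (sym (coeff-∷ (lower j a) (d , f) q)) ⟩
  ifPos (a ! j) (coeff (lower j a) ((d , f) ∷ q)) ∎
  where
  open ≡-Reasoning
  j = toℕ i

⊗-distribʳ-++ : ∀ (p p′ q : Poly n) → (p ++ p′) ⊗ q ≡ (p ⊗ q) ++ (p′ ⊗ q)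
⊗-distribʳ-++ [] p′ q = refl
⊗-distribʳ-++ ((c , e) ∷ p) p′ q =
  trans (cong (map _ q ++_) (⊗-distribʳ-++ p p′ q)) (sym (++-assoc (map _ q) (p ⊗ q) (p′ ⊗ q)))

coeff-∑var-⊗ : ∀ (a : Vec ℕ n) (L : List (Fin n)) q →
               coeff a (foldr _⊕_ [] (map var L) ⊗ q) ≡ sum (map (λ i → coeff a (var i ⊗ q)) L)
coeff-∑var-⊗ a [] q = refl
coeff-∑var-⊗ a (i ∷ L) q = begin
  coeff a ((var i ⊕ rest) ⊗ q)             ≡⟨ cong (coeff a) (⊗-distribʳ-++ (var i) rest q) ⟩
  coeff a ((var i ⊗ q) ++ (rest ⊗ q))      ≡⟨ coeff-++ a (var i ⊗ q) (rest ⊗ q) ⟩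
  coeff a (var i ⊗ q) + coeff a (rest ⊗ q) ≡⟨ cong (coeff a (var i ⊗ q) +_) (coeff-∑var-⊗ a L q) ⟩
  sum (map (λ i → coeff a (var i ⊗ q)) (i ∷ L)) ∎
  where
  open ≡-Reasoning
  rest = foldr _⊕_ [] (map var L)

sum-map-filter : ∀ {A : Set} {P : A → Set} (P? : Decidable P) (F : A → ℕ) xs →
                 sum (map F (filter P? xs)) ≡ sum (map (λ x → if does (P? x) then F x else 0) xs)
sum-map-filter P? F [] = refl
sum-map-filter P? F (x ∷ xs) with does (P? x)
... | true = cong (F x +_) (sum-map-filter P? F xs)
... | false = sum-map-filter P? F xs

tabulate-∘toℕ : ∀ m (g : ℕ → ℕ) → tabulate {n = m} (g ∘ toℕ) ≡ applyUpTo g m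
tabulate-∘toℕ zero g = refl
tabulate-∘toℕ (suc m) g = cong (g 0 ∷_) (tabulate-∘toℕ m (g ∘ suc))

coeff-linForm-⊗ : ∀ K (a : Vec ℕ n) q → K ≤ n →
                  coeff a (linForm n K ⊗ q) ≡ ∑< K (λ j → ifPos (a ! j) (coeff (lower j a) q))
coeff-linForm-⊗ {n} K a q K≤n = begin
  coeff a (linForm n K ⊗ q)
    ≡⟨ coeff-∑var-⊗ a (filter (λ i → toℕ i <? K) (allFin n)) q ⟩
  sum (map (λ i → coeff a (var i ⊗ q)) (filter (λ i → toℕ i <? K) (allFin n)))
    ≡⟨ cong sum (map-cong (λ i → coeff-var-⊗ a i q) (filter (λ i → toℕ i <? K) (allFin n))) ⟩
  sum (map (term ∘ toℕ) (filter (λ i → toℕ i <? K) (allFin n)))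
    ≡⟨ sum-map-filter (λ i → toℕ i <? K) (term ∘ toℕ) (allFin n) ⟩
  sum (map (truncated ∘ toℕ) (allFin n))
    ≡⟨ cong sum (trans (map-tabulate id (truncated ∘ toℕ)) (tabulate-∘toℕ n truncated)) ⟩
  ∑< n truncated
    ≡⟨ ∑<-truncate n K term K≤n ⟩
  ∑< K term ∎
  where
  open ≡-Reasoning
  term truncated : ℕ → ℕ
  term j = ifPos (a ! j) (coeff (lower j a) q)
  truncated j = if does (j <? K) then term j else 0

linProd : List ℕ → Poly n
linProd {n} ks = foldr _⊗_ one (map (λ k → linForm n (suc k)) ks)

coeffProd : List ℕ → Vec ℕ n → ℕ
coeffProd ks b = coeff b (linProd ks)

-- The coefficient of x^b in x_j · linProd ks.
coeffVarProd : List ℕ → Vec ℕ n → ℕ → ℕ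
coeffVarProd ks b j = ifPos (b ! j) (coeffProd ks (lower j b))

coeffProd-∷ : ∀ k ks (b : Vec ℕ n) → k < n → coeffProd (k ∷ ks) b ≡ ∑< (suc k) (coeffVarProd ks b)
coeffProd-∷ k ks b = coeff-linForm-⊗ (suc k) b (linProd ks)

coeffProd-[] : ∀ (b : Vec ℕ n) → replicate n 0 ≢ b → coeffProd [] b ≡ 0
coeffProd-[] {n} b 0≢b with ≡-dec _≟_ (replicate n 0) b
... | yes 0≡b = contradiction 0≡b 0≢b
... | no _ = refl

sum-replicate-zero : ∀ n → sum (toList (replicate n 0)) ≡ 0
sum-replicate-zero zero = refl
sum-replicate-zero (suc n) = sum-replicate-zero n

coeffProd-off-degree : ∀ ks (b : Vec ℕ n) → All (_< n) ks → sum (toList b) ≢ length ks → coeffProd ks b ≡ 0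
coeffProd-off-degree {n} [] b _ deg≢ =
  coeffProd-[] b (λ 0≡b → deg≢ (trans (cong (sum ∘ toList) (sym 0≡b)) (sum-replicate-zero n)))
coeffProd-off-degree (k ∷ ks) b (k<n ∷ ks<n) deg≢ =
  trans (coeffProd-∷ k ks b k<n) (trans (∑<-cong (suc k) vanish) (∑<-zero (suc k)))
  where
  vanish : ∀ j → j < suc k → ifPos (b ! j) (coeffProd ks (lower j b)) ≡ 0
  vanish j _ with b ! j in b!j
  ... | zero = refl
  ... | suc _ = coeffProd-off-degree ks (lower j b) ks<n
                  (λ e → deg≢ (trans (sym (tailSum-lower j 0 b z≤n (subst (1 ≤_) (sym b!j) (s≤s z≤n)))) (cong suc e)))

-- Coefficientwise form of ∂(∏ ks)/∂x_x = ∂(∏ ks)/∂x_y, read off at the monomial x^b / x_x.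
PartialsAgree : (n : ℕ) → List ℕ → ℕ → ℕ → Set
PartialsAgree n ks x y = ∀ (b : Vec ℕ n) → 1 ≤ b ! x → suc (b ! y) * coeffProd ks (move x y b) ≡ b ! x * coeffProd ks b

module _ (ks : List ℕ) {x y : ℕ} (b : Vec ℕ n) where

  coeffVarProd-move-≢ : ∀ {j l r} → j ≢ x → j ≢ y →
    (1 ≤ b ! j → l * coeffProd ks (move x y (lower j b)) ≡ r * coeffProd ks (lower j b)) →
    l * coeffVarProd ks (move x y b) j ≡ r * coeffVarProd ks b j
  coeffVarProd-move-≢ {j} {l} {r} j≢x j≢y h rewrite !-move-≢ b j≢x j≢y | lower-move b j≢x j≢y = *-ifPos (b ! j) l r h

  coeffVarProd-move-target : x ≢ y → y < n → coeffVarProd ks (move x y b) y ≡ coeffProd ks (lower x b)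
  coeffVarProd-move-target x≢y y<n rewrite !-move-target b x≢y y<n = cong (coeffProd ks) (lower-move-target b)

  module _ (agree : PartialsAgree n ks x y) (x≢y : x ≢ y) where

    coeffVarProd-move-source : x < n →
      suc (b ! y) * coeffVarProd ks (move x y b) x ≡ pred (b ! x) * coeffProd ks (lower x b)
    coeffVarProd-move-source x<n rewrite !-move-source b x≢y x<n | lower-move-source b x≢y =
      trans (*-ifPos (pred (b ! x)) (suc (b ! y)) (pred (b ! x)) agree-lower) (*-ifPos-self (pred (b ! x)) _)
      where
      agree-lower : 1 ≤ pred (b ! x) → suc (b ! y) * coeffProd ks (move x y (lower x b)) ≡ pred (b ! x) * coeffProd ks (lower x b)
      agree-lower p = subst₂ (λ u v → suc u * coeffProd ks (move x y (lower x b)) ≡ v * coeffProd ks (lower x b))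
                        (!-adjust-≢ x y pred b x≢y) (!-adjust-≡ x pred b x<n)
                        (agree (lower x b) (subst (1 ≤_) (sym (!-adjust-≡ x pred b x<n)) p))

    coeffVarProd-exchange : 1 ≤ b ! x → b ! x * coeffVarProd ks b y ≡ b ! y * coeffProd ks (lower x b)
    coeffVarProd-exchange px =
      trans (*-ifPos (b ! y) (b ! x) (b ! y) agree-lower) (*-ifPos-self (b ! y) _)
      where
      y≢x = x≢y ∘ sym
      agree-lower : 1 ≤ b ! y → b ! x * coeffProd ks (lower y b) ≡ b ! y * coeffProd ks (lower x b)
      agree-lower py = sym (subst₂ (λ u v → u * coeffProd ks v ≡ b ! x * coeffProd ks (lower y b))
        (trans (cong suc (!-adjust-≡ y pred b (!-pos⇒< b y py))) (suc-pred (b ! y) {{>-nonZero py}}))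
        (move-lower-target b x≢y py)
        (subst (λ u → suc (lower y b ! y) * coeffProd ks (move x y (lower y b)) ≡ u * coeffProd ks (lower y b))
          (!-adjust-≢ y x pred b y≢x)
          (agree (lower y b) (subst (1 ≤_) (sym (!-adjust-≢ y x pred b y≢x)) px))))

    coeffVarProd-move-other : ∀ {j} → 1 ≤ b ! x → j ≢ x → j ≢ y →
      suc (b ! y) * coeffVarProd ks (move x y b) j ≡ b ! x * coeffVarProd ks b j
    coeffVarProd-move-other {j} px j≢x j≢y = coeffVarProd-move-≢ {l = suc (b ! y)} {r = b ! x} j≢x j≢y λ _ →
      subst₂ (λ u v → suc u * coeffProd ks (move x y (lower j b)) ≡ v * coeffProd ks (lower j b))
        (!-adjust-≢ j y pred b j≢y) (!-adjust-≢ j x pred b j≢x)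
        (agree (lower j b) (subst (1 ≤_) (sym (!-adjust-≢ j x pred b j≢x)) px))

partialsAgree-linProd : ∀ {x y} ks → All (λ k → x ≤ k × y ≤ k × k < n) ks → x ≢ y → y < n → PartialsAgree n ks x y
partialsAgree-linProd {n} {x} {y} [] _ x≢y y<n b px = begin
  suc (b ! y) * coeffProd [] (move x y b) ≡⟨ cong (suc (b ! y) *_) (coeffProd-[] _ (nonzero-at y (move x y b) target-pos)) ⟩
  suc (b ! y) * 0                         ≡⟨ *-zeroʳ (suc (b ! y)) ⟩
  0                                       ≡⟨ sym (*-zeroʳ (b ! x)) ⟩
  b ! x * 0                               ≡⟨ cong (b ! x *_) (sym (coeffProd-[] b (nonzero-at x b px))) ⟩
  b ! x * coeffProd [] b                  ∎
  where
  open ≡-Reasoning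
  nonzero-at : ∀ j (v : Vec ℕ n) → 1 ≤ v ! j → replicate n 0 ≢ v
  nonzero-at j v p refl = contradiction (subst (1 ≤_) (!-replicate n j) p) λ ()
  target-pos : 1 ≤ move x y b ! y
  target-pos = subst (1 ≤_) (sym (!-move-target b x≢y y<n)) (s≤s z≤n)
partialsAgree-linProd {n} {x} {y} (k ∷ ks) ((x≤k , y≤k , k<n) ∷ bounds) x≢y y<n b px = begin
  suc β * coeffProd (k ∷ ks) b′               ≡⟨ cong (suc β *_) (coeffProd-∷ k ks b′ k<n) ⟩
  suc β * ∑< (suc k) (coeffVarProd ks b′)     ≡⟨ sym (∑<-*ˡ (suc k) (suc β) (coeffVarProd ks b′)) ⟩
  ∑< (suc k) (λ j → suc β * coeffVarProd ks b′ j)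
    ≡⟨ ∑<-exchange₂ (suc k) x y (s≤s x≤k) (s≤s y≤k) x≢y (λ j _ → coeffVarProd-move-other ks b agree x≢y px) pair ⟩
  ∑< (suc k) (λ j → α * coeffVarProd ks b j)  ≡⟨ ∑<-*ˡ (suc k) α (coeffVarProd ks b) ⟩
  α * ∑< (suc k) (coeffVarProd ks b)          ≡⟨ cong (α *_) (sym (coeffProd-∷ k ks b k<n)) ⟩
  α * coeffProd (k ∷ ks) b                    ∎
  where
  open ≡-Reasoning
  α = b ! x
  β = b ! y
  b′ = move x y b
  Z = coeffProd ks (lower x b)
  agree : PartialsAgree n ks x y
  agree = partialsAgree-linProd ks bounds x≢y y<n
  unit-shift : ∀ a c z → a * z + suc c * z ≡ suc a * z + c * z
  unit-shift = solve-∀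
  pair : suc β * coeffVarProd ks b′ x + suc β * coeffVarProd ks b′ y ≡ α * coeffVarProd ks b x + α * coeffVarProd ks b y
  pair = begin
    suc β * coeffVarProd ks b′ x + suc β * coeffVarProd ks b′ y
      ≡⟨ cong₂ _+_ (coeffVarProd-move-source ks b agree x≢y (!-pos⇒< b x px))
                   (cong (suc β *_) (coeffVarProd-move-target ks b x≢y y<n)) ⟩
    pred α * Z + suc β * Z        ≡⟨ unit-shift (pred α) β Z ⟩
    suc (pred α) * Z + β * Z      ≡⟨ cong (λ a → a * Z + β * Z) (suc-pred α {{>-nonZero px}}) ⟩
    α * Z + β * Z                 ≡⟨ cong₂ _+_ (cong (α *_) (sym (ifPos-pos α Z px)))
                                               (sym (coeffVarProd-exchange ks b agree x≢y px)) ⟩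
    α * coeffVarProd ks b x + α * coeffVarProd ks b y ∎

slack : ℕ → List ℕ → Vec ℕ n → ℕ
slack p post b = length post ∸ tailSum (suc p) b

slack-on-degree : ∀ p post (b : Vec ℕ n) → sum (toList b) ≡ suc (length post) → 1 ≤ b ! p →
                  slack p post b ≡ ∑< p (b !_) + pred (b ! p)
slack-on-degree p post b deg pα = begin
  length post ∸ T              ≡⟨ cong (_∸ T) (suc-injective (begin
    suc (length post)            ≡⟨ sym deg ⟩
    sum (toList b)               ≡⟨ sum≡∑<+tailSum p b ⟩
    σ + tailSum p b              ≡⟨ cong (σ +_) (tailSum-split p b) ⟩
    σ + (b ! p + T)              ≡⟨ cong (λ a → σ + (a + T)) (sym (suc-pred (b ! p) {{>-nonZero pα}})) ⟩
    σ + (suc (pred (b ! p)) + T) ≡⟨ regroup σ (pred (b ! p)) T ⟩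
    suc (σ + pred (b ! p) + T)   ∎)) ⟩
  σ + pred (b ! p) + T ∸ T     ≡⟨ m+n∸n≡m (σ + pred (b ! p)) T ⟩
  σ + pred (b ! p)             ∎
  where
  open ≡-Reasoning
  σ = ∑< p (b !_)
  T = tailSum (suc p) b
  regroup : ∀ s a t → s + (suc a + t) ≡ suc (s + a + t)
  regroup = solve-∀

move-across-algebra : ∀ β σ α A B X Y → 1 ≤ α →
  suc β * A ≡ α * X → suc β * B ≡ pred α * Y → α * X ≡ σ * Y →
  suc β * suc (σ + pred α) * (A + B) ≡ α * (σ + pred α) * (X + Y)
move-across-algebra β σ (suc a) A B X Y _ h₁ h₂ h₃ = begin
  suc β * suc (σ + a) * (A + B)        ≡⟨ factor β (σ + a) A B ⟩
  suc (σ + a) * (suc β * A + suc β * B) ≡⟨ cong (λ s → suc (σ + a) * s) (cong₂ _+_ (trans h₁ h₃) h₂) ⟩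
  suc (σ + a) * (σ * Y + a * Y)        ≡⟨ trade σ a Y ⟩
  (σ + a) * (σ * Y + suc a * Y)        ≡⟨ cong (λ s → (σ + a) * (s + suc a * Y)) (sym h₃) ⟩
  (σ + a) * (suc a * X + suc a * Y)    ≡⟨ unfactor a (σ + a) X Y ⟩
  suc a * (σ + a) * (X + Y)            ∎
  where
  open ≡-Reasoning
  factor : ∀ β u A B → suc β * suc u * (A + B) ≡ suc u * (suc β * A + suc β * B)
  factor = solve-∀
  trade : ∀ σ a y → suc (σ + a) * (σ * y + a * y) ≡ (σ + a) * (σ * y + suc a * y)
  trade = solve-∀
  unfactor : ∀ a u X Y → u * (suc a * X + suc a * Y) ≡ suc a * u * (X + Y)
  unfactor = solve-∀

coeffProd-move-across-on-degree : ∀ p post (b : Vec ℕ n) → suc p < n →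
  All (λ k → suc p ≤ k × k < n) post → 1 ≤ b ! p → sum (toList b) ≡ suc (length post) →
  suc (b ! suc p) * suc (slack p post b) * coeffProd (p ∷ post) (move p (suc p) b)
    ≡ b ! p * slack p post b * coeffProd (p ∷ post) b
coeffProd-move-across-on-degree {n} p post b q<n post-bounds pα deg = begin
  suc β * suc U * coeffProd (p ∷ post) b′  ≡⟨ cong (suc β * suc U *_) (expand b′) ⟩
  suc β * suc U * (A + B)                  ≡⟨ cong (λ u → suc β * suc u * (A + B)) U≡ ⟩
  suc β * suc (σ + pred α) * (A + B)       ≡⟨ move-across-algebra β σ α A B X Y pα h₁ h₂ h₃ ⟩
  α * (σ + pred α) * (X + Y)               ≡⟨ cong₂ (λ u c → α * u * c) (sym U≡) (sym (trans (expand b) (cong (X +_) (ifPos-pos α Y pα)))) ⟩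
  α * U * coeffProd (p ∷ post) b           ∎
  where
  open ≡-Reasoning
  q = suc p
  α = b ! p
  β = b ! q
  b′ = move p q b
  U = slack p post b
  σ = ∑< p (b !_)
  A = ∑< p (coeffVarProd post b′)
  B = coeffVarProd post b′ p
  X = ∑< p (coeffVarProd post b)
  Y = coeffProd post (lower p b)
  p<n = <-trans (n<1+n p) q<n
  p≢q : p ≢ q
  p≢q = <⇒≢ (n<1+n p)
  U≡ : U ≡ σ + pred α
  U≡ = slack-on-degree p post b deg pα
  expand : ∀ v → coeffProd (p ∷ post) v ≡ ∑< p (coeffVarProd post v) + coeffVarProd post v p
  expand v = trans (coeffProd-∷ p post v p<n) (∑<-suc p (coeffVarProd post v))
  agree : ∀ {y} → y < n → y ≤ q → p ≢ y → PartialsAgree n post p y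
  agree y<n y≤q p≢y = partialsAgree-linProd post
    (All.map (λ (q≤k , k<n) → ≤-trans (n≤1+n p) q≤k , ≤-trans y≤q q≤k , k<n) post-bounds) p≢y y<n
  agree-pq = agree q<n ≤-refl p≢q
  h₁ : suc β * A ≡ α * X
  h₁ = begin
    suc β * A                                       ≡⟨ sym (∑<-*ˡ p (suc β) (coeffVarProd post b′)) ⟩
    ∑< p (λ j → suc β * coeffVarProd post b′ j)     ≡⟨ ∑<-cong p (λ j j<p →
        coeffVarProd-move-other post b agree-pq p≢q pα (<⇒≢ j<p) (<⇒≢ (m<n⇒m<1+n j<p))) ⟩
    ∑< p (λ j → α * coeffVarProd post b j)          ≡⟨ ∑<-*ˡ p α (coeffVarProd post b) ⟩
    α * X                                           ∎
  h₂ : suc β * B ≡ pred α * Y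
  h₂ = coeffVarProd-move-source post b agree-pq p≢q p<n
  h₃ : α * X ≡ σ * Y
  h₃ = begin
    α * X                                  ≡⟨ sym (∑<-*ˡ p α (coeffVarProd post b)) ⟩
    ∑< p (λ j → α * coeffVarProd post b j) ≡⟨ ∑<-cong p (λ j j<p →
        coeffVarProd-exchange post b (agree (<-trans j<p p<n) (≤-trans (<⇒≤ j<p) (n≤1+n p)) (≢-sym (<⇒≢ j<p))) (≢-sym (<⇒≢ j<p)) pα) ⟩
    ∑< p (λ j → b ! j * Y)                 ≡⟨ ∑<-*ʳ p (b !_) Y ⟩
    σ * Y                                  ∎

coeffProd-move-across-head : ∀ p post (b : Vec ℕ n) → suc p < n →
  All (λ k → suc p ≤ k × k < n) post → 1 ≤ b ! p →
  suc (b ! suc p) * suc (slack p post b) * coeffProd (p ∷ post) (move p (suc p) b)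
    ≡ b ! p * slack p post b * coeffProd (p ∷ post) b
coeffProd-move-across-head {n} p post b q<n post-bounds pα with sum (toList b) ≟ suc (length post)
... | yes deg = coeffProd-move-across-on-degree p post b q<n post-bounds pα deg
... | no deg≢ = begin
  suc (b ! q) * suc U * coeffProd (p ∷ post) (move p q b) ≡⟨ cong (suc (b ! q) * suc U *_) (vanish (move p q b) moved-deg≢) ⟩
  suc (b ! q) * suc U * 0                                  ≡⟨ *-zeroʳ (suc (b ! q) * suc U) ⟩
  0                                                        ≡⟨ sym (*-zeroʳ (b ! p * U)) ⟩
  b ! p * U * 0                                            ≡⟨ cong (b ! p * U *_) (sym (vanish b deg≢)) ⟩
  b ! p * U * coeffProd (p ∷ post) b                       ∎
  where
  open ≡-Reasoning
  q = suc p
  U = slack p post b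
  vanish : ∀ v → sum (toList v) ≢ suc (length post) → coeffProd (p ∷ post) v ≡ 0
  vanish v = coeffProd-off-degree (p ∷ post) v (<-trans (n<1+n p) q<n ∷ All.map proj₂ post-bounds)
  moved-deg≢ : sum (toList (move p q b)) ≢ suc (length post)
  moved-deg≢ e = deg≢ (trans (sym (sum-move b q<n pα)) e)

-- The factors of pre involve only x_0 … x_{p−1}, so peeling them leaves b_p, b_{p+1} and the slack unchanged.
coeffProd-move-across : ∀ p pre post (b : Vec ℕ n) → suc p < n →
  All (_< p) pre → All (λ k → suc p ≤ k × k < n) post → 1 ≤ b ! p →
  suc (b ! suc p) * suc (slack p post b) * coeffProd (pre ++ p ∷ post) (move p (suc p) b)
    ≡ b ! p * slack p post b * coeffProd (pre ++ p ∷ post) b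
coeffProd-move-across p [] post b q<n [] post-bounds pα = coeffProd-move-across-head p post b q<n post-bounds pα
coeffProd-move-across {n} p (k ∷ pre) post b q<n (k<p ∷ pre-bounds) post-bounds pα = begin
  L * coeffProd (k ∷ rest) b′                  ≡⟨ cong (L *_) (coeffProd-∷ k rest b′ k<n) ⟩
  L * ∑< (suc k) (coeffVarProd rest b′)        ≡⟨ sym (∑<-*ˡ (suc k) L (coeffVarProd rest b′)) ⟩
  ∑< (suc k) (λ j → L * coeffVarProd rest b′ j) ≡⟨ ∑<-cong (suc k) (λ j j≤k → let j<p = ≤-<-trans (≤-pred j≤k) k<p in
      coeffVarProd-move-≢ rest b {l = L} {r = R} (<⇒≢ j<p) (<⇒≢ (m<n⇒m<1+n j<p)) (λ _ → peeled j j<p)) ⟩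
  ∑< (suc k) (λ j → R * coeffVarProd rest b j)  ≡⟨ ∑<-*ˡ (suc k) R (coeffVarProd rest b) ⟩
  R * ∑< (suc k) (coeffVarProd rest b)         ≡⟨ cong (R *_) (sym (coeffProd-∷ k rest b k<n)) ⟩
  R * coeffProd (k ∷ rest) b                   ∎
  where
  open ≡-Reasoning
  q = suc p
  rest = pre ++ p ∷ post
  b′ = move p q b
  U = slack p post b
  L = suc (b ! q) * suc U
  R = b ! p * U
  k<n = <-trans k<p (<-trans (n<1+n p) q<n)
  peeled : ∀ j → j < p → L * coeffProd rest (move p q (lower j b)) ≡ R * coeffProd rest (lower j b)
  peeled j j<p = begin
    suc (b ! q) * suc U * coeffProd rest (move p q v)
      ≡⟨ cong₂ (λ u w → suc u * suc w * coeffProd rest (move p q v)) (sym v!q) (sym slack-v) ⟩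
    suc (v ! q) * suc (slack p post v) * coeffProd rest (move p q v)
      ≡⟨ coeffProd-move-across p pre post v q<n pre-bounds post-bounds (subst (1 ≤_) (sym v!p) pα) ⟩
    v ! p * slack p post v * coeffProd rest v
      ≡⟨ cong₂ (λ a w → a * w * coeffProd rest v) v!p slack-v ⟩
    b ! p * U * coeffProd rest v ∎
    where
    v = lower j b
    v!p = !-adjust-≢ j p pred b (<⇒≢ j<p)
    v!q = !-adjust-≢ j q pred b (<⇒≢ (m<n⇒m<1+n j<p))
    slack-v = cong (length post ∸_) (tailSum-adjust-< j q pred b (m<n⇒m<1+n j<p))

applyUpTo-split : ∀ {A : Set} (f : ℕ → A) p l →
                  applyUpTo f (p + suc l) ≡ applyUpTo f p ++ f p ∷ applyUpTo (f ∘ (suc p +_)) l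
applyUpTo-split f zero l = refl
applyUpTo-split f (suc p) l = cong (f 0 ∷_) (applyUpTo-split (f ∘ suc) p l)

upTo-split : ∀ p → p < n → upTo n ≡ upTo p ++ p ∷ applyUpTo (suc p +_) (n ∸ suc p)
upTo-split {n} p p<n =
  trans (cong upTo (sym (trans (+-suc p (n ∸ suc p)) (m+[n∸m]≡n p<n)))) (applyUpTo-split id p (n ∸ suc p))

tailSum-bound : ∀ {k} (a : Vec ℕ n) → InA n a → k < n → tailSum k a ≤ n ∸ k
tailSum-bound {k = zero} a (_ , total) _ = ≤-reflexive total
tailSum-bound {n} {k = suc k} a (tails , _) k<n =
  tails (suc k) (s≤s z≤n) (m+n≤o⇒m≤o∸n (suc k) (subst (_≤ n) (+-comm 1 (suc k)) k<n))

entry+tailSum-bound : ∀ {p} (a : Vec ℕ n) → InA n a → p < n → a ! p + tailSum (suc p) a ≤ suc (n ∸ suc p)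
entry+tailSum-bound {p = p} a inA p<n =
  subst₂ _≤_ (tailSum-split p a) (+-∸-assoc 1 p<n) (tailSum-bound a inA p<n)

InA-move : ∀ p (a : Vec ℕ n) → suc p < n → 2 ≤ a ! p → InA n a → InA n (move p (suc p) a)
InA-move {n} p a q<n 2≤α inA@(tails , total) = tails′ , trans (sum-move a q<n pα) total
  where
  q = suc p
  pα = ≤-trans (s≤s z≤n) 2≤α
  tails′ : ∀ k → 1 ≤ k → k ≤ n ∸ 1 → tailSum k (move p q a) ≤ n ∸ k
  tails′ k 1≤k k≤n-1 with <-cmp k q
  ... | tri< k<q _ _ = subst (_≤ n ∸ k) (sym (tailSum-move-≤ a k (≤-pred k<q) (<⇒≤ k<q) q<n pα)) (tails k 1≤k k≤n-1)
  ... | tri> _ _ q<k = subst (_≤ n ∸ k) (sym (tailSum-move-> a k (<-trans (n<1+n p) q<k) q<k)) (tails k 1≤k k≤n-1)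
  ... | tri≈ _ refl _ = subst (_≤ n ∸ q) (sym (tailSum-move-between a q (n<1+n p) ≤-refl q<n))
    (≤-pred (≤-trans (+-monoˡ-≤ (tailSum q a) 2≤α) (entry+tailSum-bound a inA (<-trans (n<1+n p) q<n))))

[1+m][1+n]≤o*n : ∀ o m n → 2 + m ≤ o → suc m ≤ n → suc m * suc n ≤ o * n
[1+m][1+n]≤o*n o m n 2+m≤o 1+m≤n = begin
  suc m * suc n      ≡⟨ *-suc (suc m) n ⟩
  suc m + suc m * n  ≤⟨ +-monoˡ-≤ (suc m * n) 1+m≤n ⟩
  (2 + m) * n        ≤⟨ *-monoˡ-≤ n 2+m≤o ⟩
  o * n              ∎
  where open ≤-Reasoning

c≤c-move : ∀ p (a : Vec ℕ n) → suc p < n → a ! p > a ! suc p + 1 → InA n a → c a ≤ c (move p (suc p) a)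
c≤c-move {n} p a q<n gap inA =
  subst (λ ks → coeffProd ks a ≤ coeffProd ks a′) (sym (upTo-split p p<n)) (*-cancelˡ-≤ (suc β * suc U) (begin
    suc β * suc U * coeffProd ks a  ≤⟨ *-monoˡ-≤ (coeffProd ks a) ([1+m][1+n]≤o*n α β U 2+β≤α (m+n≤o⇒m≤o∸n (suc β) β+T≤l)) ⟩
    α * U * coeffProd ks a          ≡⟨ sym (coeffProd-move-across p pre post a q<n pre-bounds post-bounds (≤-trans (s≤s z≤n) 2+β≤α)) ⟩
    suc β * suc U * coeffProd ks a′ ∎))
  where
  open ≤-Reasoning
  q = suc p
  p<n = <-trans (n<1+n p) q<n
  α = a ! p
  β = a ! q
  a′ = move p q a
  pre = upTo p
  post = applyUpTo (q +_) (n ∸ q)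
  ks = pre ++ p ∷ post
  U = slack p post a
  2+β≤α : 2 + β ≤ α
  2+β≤α = subst (_< α) (+-comm β 1) gap
  β+T≤l : suc β + tailSum q a ≤ length post
  β+T≤l = subst (suc β + tailSum q a ≤_) (sym (length-applyUpTo (q +_) (n ∸ q)))
                (≤-pred (≤-trans (+-monoˡ-≤ (tailSum q a) 2+β≤α) (entry+tailSum-bound a inA p<n)))
  pre-bounds : All (_< p) pre
  pre-bounds = applyUpTo⁺₁ id p id
  post-bounds : All (λ k → q ≤ k × k < n) post
  post-bounds = applyUpTo⁺₁ (q +_) (n ∸ q) λ {i} i<l →
    m≤m+n q i , subst (q + i <_) (m+[n∸m]≡n p<n) (+-monoʳ-< q i<l)

lemma10 : (n : ℕ) (a : Vec ℕ n) → InA n a →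
    (i : ℕ) (hi : suc i < n) →
    lookup a (fromℕ< (≤-trans (n≤1+n (suc i)) hi)) > lookup a (fromℕ< hi) + 1 →
    InA n ((a [ fromℕ< (≤-trans (n≤1+n (suc i)) hi) ]%= pred) [ fromℕ< hi ]%= suc)
    × c a ≤ c ((a [ fromℕ< (≤-trans (n≤1+n (suc i)) hi) ]%= pred) [ fromℕ< hi ]%= suc)
lemma10 n a inA p hi gap
  rewrite adjust-fromℕ< p (≤-trans (n≤1+n (suc p)) hi) pred a
        | adjust-fromℕ< (suc p) hi suc (lower p a)
        | lookup-fromℕ< p (≤-trans (n≤1+n (suc p)) hi) a
        | lookup-fromℕ< (suc p) hi a
  = InA-move p a hi (≤-trans (s≤s (m≤n+m 1 (a ! suc p))) gap) inA , c≤c-move p a hi gap inA
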